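{- For every closed term $M$ and every value $V$: if $M\to_{a\cup\beta}^{*} V$, then $(\overline{M})~\lambda x\,x\to_{\ell\cup\beta}^{*}\Phi(V)$.
   Context: Fix a ring of scalars (elements $\alpha,\beta$). Terms, values and base terms are given by: $M,N,L ::= V \mid (M)~N \mid \alpha.M \mid M+N$ (terms); $U,V,W ::= 0 \mid B \mid \alpha.V \mid V+W$ (values); $B ::= x \mid \lambda x\,M$ (base terms). Terms are taken up to renaming of bound variables; $M[x:=N]$ is capture-avoiding substitution. Below $V$ is a value and $B$ a base term. Rewrite rules: $(\beta_n)$ $(\lambda x\,M)~N\to M[x:=N]$. $(A)$ $(M+N)~L\to (M)~L+(N)~L$; $(\alpha.M)~N\to\alpha.(M)~N$; $(0)~M\to 0$. $(\beta_v)$ $(\lambda x\,M)~B\to M[x:=B]$. $(A_l)$ $(M+N)~V\to(M)~V+(N)~V$; $(\alpha.M)~V\to\alpha.(M)~V$; $(0)~V\to 0$. $(A_r)$ $(B)~(M+N)\to(B)~M+(B)~N$; $(B)~(\alpha.M)\to\alpha.(B)~M$; $(B)~0\to 0$. (Asso) $M+(N+L)\to(M+N)+L$ and $(M+N)+L\to M+(N+L)$. (Com) $M+N\to N+M$. $(F)$ $\alpha.M+\beta.M\to(\alpha+\beta).M$; $\alpha.M+M\to(\alpha+1).M$; $M+M\to(1+1).M$; $\alpha.(\beta.M)\to(\alpha\beta).M$. $(S)$ $\alpha.(M+N)\to\alpha.M+\alpha.N$; $1.M\to M$; $0.M\to 0$; $\alpha.0\to 0$; $0+M\to M$. Context rules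 $(\xi)$: from $M\to M'$ infer $(M)~N\to(M')~N$, $M+N\to M'+N$, $N+M\to N+M'$, $\alpha.M\to\alpha.M'$. Context rule $(\xi_{lin})$: from $M\to M'$ infer $(V)~M\to(V)~M'$ for $V$ a value. Let $L=\mathrm{Asso}\cup\mathrm{Com}\cup F\cup S$. Define: $\to_a$ generated by $A\cup L$ closed under $\xi$; $\to_\ell$ generated by $A_l\cup A_r\cup L$ closed under $\xi,\xi_{lin}$; $\to_{\beta_v}$ generated by $\beta_v$ closed under $\xi,\xi_{lin}$; $\to_{\beta_n}$ generated by $\beta_n$ closed under $\xi$. $R^{*}$ denotes reflexive-transitive closure. Set $\to_{\ell\cup\beta}:=\to_\ell\cup\to_{\beta_v}$ and $\to_{a\cup\beta}:=\to_a\cup\to_{\beta_n}$. Translation (with $f,g,y$ fresh variables): $\overline{x}=x$; $\overline{0}=\lambda f\,(0)~f$; $\overline{\lambda x\,M}=\lambda f\,(f)~\lambda x\,\overline M$; $\overline{(M)~N}=\lambda f\,(\overline M)~\lambda g\,((g)~\overline N)~f$; $\overline{\alpha.M}=\lambda f\,(\alpha.\overline M)~f$; $\overline{M+N}=\lambda f\,(\overline M+\overline N)~f$. On values: $\Phi(x)=(x)~\lambda y\,y$, $\Phi(0)=0$, $\Phi(\lambda x\,M)=\lambda x\,\overline M$, $\Phi(\alpha.V)=\alpha.\Phi(V)$, $\Phi(V+W)=\Phi(V)+\Phi(W)$. -}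

module Defs where

open import Level using (Level)
open import Algebra.Bundles using (Ring)
open import Data.Nat using (ℕ; zero; suc)
open import Data.Fin using (Fin; zero; suc)
open import Relation.Binary.Construct.Closure.ReflexiveTransitive using (Star)

-- Terms are well-scoped de Bruijn terms (so they are automatically taken up to
-- renaming of bound variables); Term n = terms with at most n free variables,
-- Term 0 = closed terms.
module Lang {c ℓ : Level} (R : Ring c ℓ) where

  open Ring R using (Carrier; _+_; _*_; 0#; 1#)

  infixl 7 _·_
  infixl 6 _⊕_

  data Term (n : ℕ) : Set c where
    var : Fin n → Term n
    ƛ   : Term (suc n) → Term n
    app : Term n → Term n → Term n          -- (M) N
    _·_ : Carrier → Term n → Term n
    _⊕_ : Term n → Term n → Term n
    𝟘   : Term n

  data Base {n : ℕ} : Term n → Set c where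
    var : (i : Fin n) → Base (var i)
    ƛ   : (M : Term (suc n)) → Base (ƛ M)

  data Value {n : ℕ} : Term n → Set c where
    𝟘   : Value 𝟘
    base : {B : Term n} → Base B → Value B
    _·_ : (α : Carrier) {V : Term n} → Value V → Value (α · V)
    _⊕_ : {V W : Term n} → Value V → Value W → Value (V ⊕ W)

  Ren : ℕ → ℕ → Set
  Ren m n = Fin m → Fin n

  liftR : ∀ {m n} → Ren m n → Ren (suc m) (suc n)
  liftR ρ zero    = zero
  liftR ρ (suc i) = suc (ρ i)

  rename : ∀ {m n} → Ren m n → Term m → Term n
  rename ρ (var i)   = var (ρ i)
  rename ρ (ƛ M)     = ƛ (rename (liftR ρ) M)
  rename ρ (app M N) = app (rename ρ M) (rename ρ N)
  rename ρ (α · M)   = α · rename ρ M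
  rename ρ (M ⊕ N)   = rename ρ M ⊕ rename ρ N
  rename ρ 𝟘         = 𝟘

  wk : ∀ {n} → Term n → Term (suc n)
  wk = rename suc

  Sub : ℕ → ℕ → Set c
  Sub m n = Fin m → Term n

  liftS : ∀ {m n} → Sub m n → Sub (suc m) (suc n)
  liftS σ zero    = var zero
  liftS σ (suc i) = wk (σ i)

  subst : ∀ {m n} → Sub m n → Term m → Term n
  subst σ (var i)   = σ i
  subst σ (ƛ M)     = ƛ (subst (liftS σ) M)
  subst σ (app M N) = app (subst σ M) (subst σ N)
  subst σ (α · M)   = α · subst σ M
  subst σ (M ⊕ N)   = subst σ M ⊕ subst σ N
  subst σ 𝟘         = 𝟘

  sub0 : ∀ {n} → Term n → Sub (suc n) n
  sub0 N zero    = N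
  sub0 N (suc i) = var i

  _[_] : ∀ {n} → Term (suc n) → Term n → Term n
  M [ N ] = subst (sub0 N) M

  Rel : Set (Level.suc c)
  Rel = ∀ {n} → Term n → Term n → Set c

  data βn-rule : Rel where
    βn : ∀ {n} (M : Term (suc n)) (N : Term n) → βn-rule (app (ƛ M) N) (M [ N ])

  data βv-rule : Rel where
    βv : ∀ {n} (M : Term (suc n)) {B : Term n} → Base B → βv-rule (app (ƛ M) B) (M [ B ])

  data A-rule : Rel where
    A+ : ∀ {n} (M N L : Term n) → A-rule (app (M ⊕ N) L) (app M L ⊕ app N L)
    A· : ∀ {n} (α : Carrier) (M N : Term n) → A-rule (app (α · M) N) (α · app M N)
    A0 : ∀ {n} (M : Term n) → A-rule (app 𝟘 M) 𝟘

  data Al-rule : Rel where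
    Al+ : ∀ {n} (M N : Term n) {V : Term n} → Value V → Al-rule (app (M ⊕ N) V) (app M V ⊕ app N V)
    Al· : ∀ {n} (α : Carrier) (M : Term n) {V : Term n} → Value V → Al-rule (app (α · M) V) (α · app M V)
    Al0 : ∀ {n} {V : Term n} → Value V → Al-rule (app 𝟘 V) 𝟘

  data Ar-rule : Rel where
    Ar+ : ∀ {n} {B : Term n} → Base B → (M N : Term n) → Ar-rule (app B (M ⊕ N)) (app B M ⊕ app B N)
    Ar· : ∀ {n} {B : Term n} → Base B → (α : Carrier) (M : Term n) → Ar-rule (app B (α · M)) (α · app B M)
    Ar0 : ∀ {n} {B : Term n} → Base B → Ar-rule (app B 𝟘) 𝟘

  data L-rule : Rel where
    asso₁ : ∀ {n} (M N L : Term n) → L-rule (M ⊕ (N ⊕ L)) ((M ⊕ N) ⊕ L)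
    asso₂ : ∀ {n} (M N L : Term n) → L-rule ((M ⊕ N) ⊕ L) (M ⊕ (N ⊕ L))
    com   : ∀ {n} (M N : Term n) → L-rule (M ⊕ N) (N ⊕ M)
    F₁    : ∀ {n} (α β : Carrier) (M : Term n) → L-rule (α · M ⊕ β · M) ((α + β) · M)
    F₂    : ∀ {n} (α : Carrier) (M : Term n) → L-rule (α · M ⊕ M) ((α + 1#) · M)
    F₃    : ∀ {n} (M : Term n) → L-rule (M ⊕ M) ((1# + 1#) · M)
    F₄    : ∀ {n} (α β : Carrier) (M : Term n) → L-rule (α · (β · M)) ((α * β) · M)
    S₁    : ∀ {n} (α : Carrier) (M N : Term n) → L-rule (α · (M ⊕ N)) (α · M ⊕ α · N)
    S₂    : ∀ {n} (M : Term n) → L-rule (1# · M) M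
    S₃    : ∀ {n} (M : Term n) → L-rule (0# · M) 𝟘
    S₄    : ∀ {n} (α : Carrier) → L-rule {n} (α · 𝟘) 𝟘
    S₅    : ∀ {n} (M : Term n) → L-rule (𝟘 ⊕ M) M

  data _∪_ (P Q : Rel) : Rel where
    inl : ∀ {n} {M N : Term n} → P M N → (P ∪ Q) M N
    inr : ∀ {n} {M N : Term n} → Q M N → (P ∪ Q) M N

  data Ξ (P : Rel) : Rel where
    base  : ∀ {n} {M M' : Term n} → P M M' → Ξ P M M'
    appL  : ∀ {n} {M M' : Term n} (N : Term n) → Ξ P M M' → Ξ P (app M N) (app M' N)
    plusL : ∀ {n} {M M' : Term n} (N : Term n) → Ξ P M M' → Ξ P (M ⊕ N) (M' ⊕ N)
    plusR : ∀ {n} {M M' : Term n} (N : Term n) → Ξ P M M' → Ξ P (N ⊕ M) (N ⊕ M')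
    scal  : ∀ {n} {M M' : Term n} (α : Carrier) → Ξ P M M' → Ξ P (α · M) (α · M')

  data Ξlin (P : Rel) : Rel where
    base  : ∀ {n} {M M' : Term n} → P M M' → Ξlin P M M'
    appL  : ∀ {n} {M M' : Term n} (N : Term n) → Ξlin P M M' → Ξlin P (app M N) (app M' N)
    plusL : ∀ {n} {M M' : Term n} (N : Term n) → Ξlin P M M' → Ξlin P (M ⊕ N) (M' ⊕ N)
    plusR : ∀ {n} {M M' : Term n} (N : Term n) → Ξlin P M M' → Ξlin P (N ⊕ M) (N ⊕ M')
    scal  : ∀ {n} {M M' : Term n} (α : Carrier) → Ξlin P M M' → Ξlin P (α · M) (α · M')
    appR  : ∀ {n} {M M' V : Term n} → Value V → Ξlin P M M' → Ξlin P (app V M) (app V M')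

  _⟶a_ : Rel
  _⟶a_ = Ξ (A-rule ∪ L-rule)

  _⟶ℓ_ : Rel
  _⟶ℓ_ = Ξlin ((Al-rule ∪ Ar-rule) ∪ L-rule)

  _⟶βv_ : Rel
  _⟶βv_ = Ξlin βv-rule

  _⟶βn_ : Rel
  _⟶βn_ = Ξ βn-rule

  _⟶ℓ∪β_ : Rel
  _⟶ℓ∪β_ = _⟶ℓ_ ∪ _⟶βv_

  _⟶a∪β_ : Rel
  _⟶a∪β_ = _⟶a_ ∪ _⟶βn_

  _⟶ℓ∪β*_ : ∀ {n} → Term n → Term n → Set c
  _⟶ℓ∪β*_ = Star _⟶ℓ∪β_

  _⟶a∪β*_ : ∀ {n} → Term n → Term n → Set c
  _⟶a∪β*_ = Star _⟶a∪β_

  -- the translation  M ↦ M̅   (f, g fresh: de Bruijn index 0 / 1 under the new binders)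
  tr : ∀ {n} → Term n → Term n
  tr (var i)   = var i
  tr 𝟘         = ƛ (app 𝟘 (var zero))
  tr (ƛ M)     = ƛ (app (var zero) (wk (ƛ (tr M))))
  tr (app M N) = ƛ (app (wk (tr M)) (ƛ (app (app (var zero) (wk (wk (tr N)))) (var (suc zero)))))
  tr (α · M)   = ƛ (app (α · wk (tr M)) (var zero))
  tr (M ⊕ N)   = ƛ (app (wk (tr M) ⊕ wk (tr N)) (var zero))

  I : ∀ {n} → Term n
  I = ƛ (var zero)

  Φ : ∀ {n} {V : Term n} → Value V → Term n
  Φ 𝟘                 = 𝟘
  Φ (base (var i))    = app (var i) I
  Φ (base (ƛ M))      = ƛ (tr M)
  Φ (α · v)           = α · Φ v
  Φ (v ⊕ w)           = Φ v ⊕ Φ w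

-- Plotkin's colon translation.  For a base term K, colon M K is what the CPS
-- image tr M reaches when applied to the continuation K by administrative
-- (βv and Al) steps alone.  Every step of M is mirrored on colon M K: the A
-- rules are absorbed (both sides have the same colon image), an L rule maps
-- to the same L rule, and a βn step becomes two βv steps, which is possible
-- because every translated term is a base term.  At a value V, colon V I
-- reaches Φ V.
module Submission where

open import Defs
open import Algebra.Bundles using (Ring)
open import Data.Fin using (zero)
open import Relation.Binary.PropositionalEquality using (_≡_)

open import Data.Nat using (suc)
open import Data.Fin using (suc)
open import Function using (_∘_)
open import Relation.Binary.PropositionalEquality using (refl; cong; cong₂; sym; trans)
open import Relation.Binary.Construct.Closure.ReflexiveTransitive using (ε; _◅_; _◅◅_; gmap)

module CPS {c ℓ} (R : Ring c ℓ) where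
  open Lang R

  liftR-cong : ∀ {m n} {ρ ρ' : Ren m n} → (∀ i → ρ i ≡ ρ' i) → ∀ i → liftR ρ i ≡ liftR ρ' i
  liftR-cong e zero    = refl
  liftR-cong e (suc i) = cong suc (e i)

  rename-cong : ∀ {m n} {ρ ρ' : Ren m n} → (∀ i → ρ i ≡ ρ' i) → ∀ M → rename ρ M ≡ rename ρ' M
  rename-cong e (var i)   = cong var (e i)
  rename-cong e (ƛ M)     = cong ƛ (rename-cong (liftR-cong e) M)
  rename-cong e (app M N) = cong₂ app (rename-cong e M) (rename-cong e N)
  rename-cong e (α · M)   = cong (α ·_) (rename-cong e M)
  rename-cong e (M ⊕ N)   = cong₂ _⊕_ (rename-cong e M) (rename-cong e N)
  rename-cong e 𝟘         = refl

  liftS-cong : ∀ {m n} {σ σ' : Sub m n} → (∀ i → σ i ≡ σ' i) → ∀ i → liftS σ i ≡ liftS σ' i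
  liftS-cong e zero    = refl
  liftS-cong e (suc i) = cong wk (e i)

  subst-cong : ∀ {m n} {σ σ' : Sub m n} → (∀ i → σ i ≡ σ' i) → ∀ M → subst σ M ≡ subst σ' M
  subst-cong e (var i)   = e i
  subst-cong e (ƛ M)     = cong ƛ (subst-cong (liftS-cong e) M)
  subst-cong e (app M N) = cong₂ app (subst-cong e M) (subst-cong e N)
  subst-cong e (α · M)   = cong (α ·_) (subst-cong e M)
  subst-cong e (M ⊕ N)   = cong₂ _⊕_ (subst-cong e M) (subst-cong e N)
  subst-cong e 𝟘         = refl

  rename-∘ : ∀ {k m n} (ρ : Ren m n) (ρ' : Ren k m) M → rename ρ (rename ρ' M) ≡ rename (ρ ∘ ρ') M
  rename-∘ ρ ρ' (var i)   = refl
  rename-∘ ρ ρ' (ƛ M)     = cong ƛ (trans (rename-∘ (liftR ρ) (liftR ρ') M)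
                                          (rename-cong (λ { zero → refl ; (suc i) → refl }) M))
  rename-∘ ρ ρ' (app M N) = cong₂ app (rename-∘ ρ ρ' M) (rename-∘ ρ ρ' N)
  rename-∘ ρ ρ' (α · M)   = cong (α ·_) (rename-∘ ρ ρ' M)
  rename-∘ ρ ρ' (M ⊕ N)   = cong₂ _⊕_ (rename-∘ ρ ρ' M) (rename-∘ ρ ρ' N)
  rename-∘ ρ ρ' 𝟘         = refl

  subst-rename : ∀ {k m n} (σ : Sub m n) (ρ : Ren k m) M → subst σ (rename ρ M) ≡ subst (σ ∘ ρ) M
  subst-rename σ ρ (var i)   = refl
  subst-rename σ ρ (ƛ M)     = cong ƛ (trans (subst-rename (liftS σ) (liftR ρ) M)
                                              (subst-cong (λ { zero → refl ; (suc i) → refl }) M))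
  subst-rename σ ρ (app M N) = cong₂ app (subst-rename σ ρ M) (subst-rename σ ρ N)
  subst-rename σ ρ (α · M)   = cong (α ·_) (subst-rename σ ρ M)
  subst-rename σ ρ (M ⊕ N)   = cong₂ _⊕_ (subst-rename σ ρ M) (subst-rename σ ρ N)
  subst-rename σ ρ 𝟘         = refl

  rename-subst : ∀ {k m n} (ρ : Ren m n) (σ : Sub k m) M → rename ρ (subst σ M) ≡ subst (rename ρ ∘ σ) M
  rename-subst ρ σ (var i)   = refl
  rename-subst ρ σ (ƛ M)     = cong ƛ (trans (rename-subst (liftR ρ) (liftS σ) M) (subst-cong lift-comm M))
    where
    lift-comm : ∀ i → rename (liftR ρ) (liftS σ i) ≡ liftS (rename ρ ∘ σ) i
    lift-comm zero    = refl
    lift-comm (suc i) = trans (rename-∘ (liftR ρ) suc (σ i)) (sym (rename-∘ suc ρ (σ i)))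
  rename-subst ρ σ (app M N) = cong₂ app (rename-subst ρ σ M) (rename-subst ρ σ N)
  rename-subst ρ σ (α · M)   = cong (α ·_) (rename-subst ρ σ M)
  rename-subst ρ σ (M ⊕ N)   = cong₂ _⊕_ (rename-subst ρ σ M) (rename-subst ρ σ N)
  rename-subst ρ σ 𝟘         = refl

  subst-var : ∀ {n} (M : Term n) → subst var M ≡ M
  subst-var (var i)   = refl
  subst-var (ƛ M)     = cong ƛ (trans (subst-cong (λ { zero → refl ; (suc i) → refl }) M) (subst-var M))
  subst-var (app M N) = cong₂ app (subst-var M) (subst-var N)
  subst-var (α · M)   = cong (α ·_) (subst-var M)
  subst-var (M ⊕ N)   = cong₂ _⊕_ (subst-var M) (subst-var N)
  subst-var 𝟘         = refl

  rename-liftR-wk : ∀ {m n} (ρ : Ren m n) M → rename (liftR ρ) (wk M) ≡ wk (rename ρ M)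
  rename-liftR-wk ρ M = trans (rename-∘ (liftR ρ) suc M) (sym (rename-∘ suc ρ M))

  subst-liftS-wk : ∀ {m n} (σ : Sub m n) M → subst (liftS σ) (wk M) ≡ wk (subst σ M)
  subst-liftS-wk σ M = trans (subst-rename (liftS σ) suc M) (sym (rename-subst suc σ M))

  wk-[] : ∀ {n} (M K : Term n) → wk M [ K ] ≡ M
  wk-[] M K = trans (subst-rename (sub0 K) suc M) (subst-var M)

  tr-rename : ∀ {m n} (ρ : Ren m n) M → tr (rename ρ M) ≡ rename ρ (tr M)
  tr-rename ρ (var i)   = refl
  tr-rename ρ 𝟘         = refl
  tr-rename ρ (ƛ M)     = cong (λ X → ƛ (app (var zero) X))
    (trans (cong (λ Y → wk (ƛ Y)) (tr-rename (liftR ρ) M)) (sym (rename-liftR-wk ρ (ƛ (tr M)))))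
  tr-rename ρ (app M N) = cong₂ (λ X Y → ƛ (app X (ƛ (app (app (var zero) Y) (var (suc zero))))))
    (trans (cong wk (tr-rename ρ M)) (sym (rename-liftR-wk ρ (tr M))))
    (trans (cong (wk ∘ wk) (tr-rename ρ N))
      (trans (cong wk (sym (rename-liftR-wk ρ (tr N)))) (sym (rename-liftR-wk (liftR ρ) (wk (tr N))))))
  tr-rename ρ (α · M)   = cong (λ X → ƛ (app (α · X) (var zero)))
    (trans (cong wk (tr-rename ρ M)) (sym (rename-liftR-wk ρ (tr M))))
  tr-rename ρ (M ⊕ N)   = cong₂ (λ X Y → ƛ (app (X ⊕ Y) (var zero)))
    (trans (cong wk (tr-rename ρ M)) (sym (rename-liftR-wk ρ (tr M))))
    (trans (cong wk (tr-rename ρ N)) (sym (rename-liftR-wk ρ (tr N))))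

  tr-subst : ∀ {m n} (σ : Sub m n) M → tr (subst σ M) ≡ subst (tr ∘ σ) (tr M)
  tr-subst σ (var i)   = refl
  tr-subst σ 𝟘         = refl
  tr-subst σ (ƛ M)     = cong (λ X → ƛ (app (var zero) X))
    (trans (cong (λ Y → wk (ƛ Y)) (trans (tr-subst (liftS σ) M) (subst-cong tr-liftS (tr M))))
           (sym (subst-liftS-wk (tr ∘ σ) (ƛ (tr M)))))
    where
    tr-liftS : ∀ i → tr (liftS σ i) ≡ liftS (tr ∘ σ) i
    tr-liftS zero    = refl
    tr-liftS (suc i) = tr-rename suc (σ i)
  tr-subst σ (app M N) = cong₂ (λ X Y → ƛ (app X (ƛ (app (app (var zero) Y) (var (suc zero))))))
    (trans (cong wk (tr-subst σ M)) (sym (subst-liftS-wk (tr ∘ σ) (tr M))))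
    (trans (cong (wk ∘ wk) (tr-subst σ N))
      (trans (cong wk (sym (subst-liftS-wk (tr ∘ σ) (tr N)))) (sym (subst-liftS-wk (liftS (tr ∘ σ)) (wk (tr N))))))
  tr-subst σ (α · M)   = cong (λ X → ƛ (app (α · X) (var zero)))
    (trans (cong wk (tr-subst σ M)) (sym (subst-liftS-wk (tr ∘ σ) (tr M))))
  tr-subst σ (M ⊕ N)   = cong₂ (λ X Y → ƛ (app (X ⊕ Y) (var zero)))
    (trans (cong wk (tr-subst σ M)) (sym (subst-liftS-wk (tr ∘ σ) (tr M))))
    (trans (cong wk (tr-subst σ N)) (sym (subst-liftS-wk (tr ∘ σ) (tr N))))

  tr-[] : ∀ {n} (M : Term (suc n)) N → tr (M [ N ]) ≡ tr M [ tr N ]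
  tr-[] M N = trans (tr-subst (sub0 N) M) (subst-cong (λ { zero → refl ; (suc i) → refl }) (tr M))

  tr-Base : ∀ {n} (M : Term n) → Base (tr M)
  tr-Base (var i)   = var i
  tr-Base (ƛ M)     = ƛ _
  tr-Base (app M N) = ƛ _
  tr-Base (α · M)   = ƛ _
  tr-Base (M ⊕ N)   = ƛ _
  tr-Base 𝟘         = ƛ _

  infix 4 _⟶*_

  _⟶*_ : ∀ {n} → Term n → Term n → Set c
  _⟶*_ = _⟶ℓ∪β*_

  ≡⇒⟶* : ∀ {n} {M N : Term n} → M ≡ N → M ⟶* N
  ≡⇒⟶* refl = ε

  L⇒⟶* : ∀ {n} {M N : Term n} → L-rule M N → M ⟶* N
  L⇒⟶* r = inl (base (inr r)) ◅ ε

  Al⇒⟶* : ∀ {n} {M N : Term n} → Al-rule M N → M ⟶* N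
  Al⇒⟶* r = inl (base (inl (inl r))) ◅ ε

  βv⇒⟶* : ∀ {n} {M N : Term n} → βv-rule M N → M ⟶* N
  βv⇒⟶* r = inr (base r) ◅ ε

  ⟶*-context : ∀ {n} (C : Term n → Term n) →
               (∀ {P : Rel} {M M'} → Ξlin P M M' → Ξlin P (C M) (C M')) →
               ∀ {M M'} → M ⟶* M' → C M ⟶* C M'
  ⟶*-context C ξ = gmap C λ { (inl s) → inl (ξ s) ; (inr s) → inr (ξ s) }

  ⟶*-appL : ∀ {n} (N : Term n) {M M'} → M ⟶* M' → app M N ⟶* app M' N
  ⟶*-appL N = ⟶*-context (λ X → app X N) (appL N)

  ⟶*-plusL : ∀ {n} (N : Term n) {M M'} → M ⟶* M' → M ⊕ N ⟶* M' ⊕ N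
  ⟶*-plusL N = ⟶*-context (_⊕ N) (plusL N)

  ⟶*-plusR : ∀ {n} (N : Term n) {M M'} → M ⟶* M' → N ⊕ M ⟶* N ⊕ M'
  ⟶*-plusR N = ⟶*-context (N ⊕_) (plusR N)

  ⟶*-plus : ∀ {n} {M M' N N' : Term n} → M ⟶* M' → N ⟶* N' → M ⊕ N ⟶* M' ⊕ N'
  ⟶*-plus M⟶*M' N⟶*N' = ⟶*-plusL _ M⟶*M' ◅◅ ⟶*-plusR _ N⟶*N'

  ⟶*-scal : ∀ {n} α {M M' : Term n} → M ⟶* M' → α · M ⟶* α · M'
  ⟶*-scal α = ⟶*-context (α ·_) (scal α)

  argK : ∀ {n} → Term n → Term n → Term n
  argK N K = ƛ (app (app (var zero) (wk (tr N))) (wk K))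

  colon : ∀ {n} → Term n → Term n → Term n
  colon (var i)   K = app (var i) K
  colon 𝟘         K = 𝟘
  colon (ƛ M)     K = app K (ƛ (tr M))
  colon (app M N) K = colon M (argK N K)
  colon (α · M)   K = α · colon M K
  colon (M ⊕ N)   K = colon M K ⊕ colon N K

  tr-⟶*-colon : ∀ {n} (M : Term n) {K} → Base K → app (tr M) K ⟶* colon M K
  tr-⟶*-colon (var i)   bK = ε
  tr-⟶*-colon 𝟘         bK = βv⇒⟶* (βv _ bK) ◅◅ Al⇒⟶* (Al0 (base bK))
  tr-⟶*-colon (ƛ M) {K} bK = βv⇒⟶* (βv _ bK) ◅◅ ≡⇒⟶* (cong (app K) (wk-[] (ƛ (tr M)) K))
  tr-⟶*-colon (app M N) {K} bK =
    βv⇒⟶* (βv _ bK) ◅◅ ≡⇒⟶* continuation-[] ◅◅ tr-⟶*-colon M (ƛ _)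
    where
    continuation-[] : app (wk (tr M)) (ƛ (app (app (var zero) (wk (wk (tr N)))) (var (suc zero)))) [ K ]
                      ≡ app (tr M) (argK N K)
    continuation-[] = cong₂ (λ X Y → app X (ƛ (app (app (var zero) Y) (wk K))))
      (wk-[] (tr M) K)
      (trans (subst-liftS-wk (sub0 K) (wk (tr N))) (cong wk (wk-[] (tr N) K)))
  tr-⟶*-colon (α · M) {K} bK =
    βv⇒⟶* (βv _ bK) ◅◅ ≡⇒⟶* (cong (λ X → app (α · X) K) (wk-[] (tr M) K))
    ◅◅ Al⇒⟶* (Al· α (tr M) (base bK)) ◅◅ ⟶*-scal α (tr-⟶*-colon M bK)
  tr-⟶*-colon (M ⊕ N) {K} bK =
    βv⇒⟶* (βv _ bK) ◅◅ ≡⇒⟶* (cong₂ (λ X Y → app (X ⊕ Y) K) (wk-[] (tr M) K) (wk-[] (tr N) K))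
    ◅◅ Al⇒⟶* (Al+ (tr M) (tr N) (base bK)) ◅◅ ⟶*-plus (tr-⟶*-colon M bK) (tr-⟶*-colon N bK)

  colon-L : ∀ {n} {M M' : Term n} → L-rule M M' → ∀ K → L-rule (colon M K) (colon M' K)
  colon-L (asso₁ M N L) K = asso₁ _ _ _
  colon-L (asso₂ M N L) K = asso₂ _ _ _
  colon-L (com M N)     K = com _ _
  colon-L (F₁ α β M)    K = F₁ α β _
  colon-L (F₂ α M)      K = F₂ α _
  colon-L (F₃ M)        K = F₃ _
  colon-L (F₄ α β M)    K = F₄ α β _
  colon-L (S₁ α M N)    K = S₁ α _ _
  colon-L (S₂ M)        K = S₂ _
  colon-L (S₃ M)        K = S₃ _
  colon-L (S₄ α)        K = S₄ α
  colon-L (S₅ M)        K = S₅ _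

  colon-A∪L : ∀ {n} {M M' : Term n} → (A-rule ∪ L-rule) M M' → ∀ K → colon M K ⟶* colon M' K
  colon-A∪L (inl (A+ M N L)) K = ε
  colon-A∪L (inl (A· α M N)) K = ε
  colon-A∪L (inl (A0 M))     K = ε
  colon-A∪L (inr r)          K = L⇒⟶* (colon-L r K)

  colon-βn : ∀ {n} {M M' : Term n} → βn-rule M M' → ∀ {K} → Base K → colon M K ⟶* colon M' K
  colon-βn (βn M N) {K} bK =
    βv⇒⟶* (βv _ (ƛ (tr M)))
    ◅◅ ≡⇒⟶* (cong₂ (λ X Y → app (app (ƛ (tr M)) X) Y) (wk-[] (tr N) _) (wk-[] K _))
    ◅◅ ⟶*-appL K (βv⇒⟶* (βv (tr M) (tr-Base N)))
    ◅◅ ≡⇒⟶* (cong (λ X → app X K) (sym (tr-[] M N)))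
    ◅◅ tr-⟶*-colon (M [ N ]) bK

  colon-Ξ : ∀ {P : Rel} →
            (∀ {n} {M M' : Term n} → P M M' → ∀ {K} → Base K → colon M K ⟶* colon M' K) →
            ∀ {n} {M M' : Term n} → Ξ P M M' → ∀ {K} → Base K → colon M K ⟶* colon M' K
  colon-Ξ colon-P (base r)    bK = colon-P r bK
  colon-Ξ colon-P (appL N s)  bK = colon-Ξ colon-P s (ƛ _)
  colon-Ξ colon-P (plusL N s) bK = ⟶*-plusL _ (colon-Ξ colon-P s bK)
  colon-Ξ colon-P (plusR N s) bK = ⟶*-plusR _ (colon-Ξ colon-P s bK)
  colon-Ξ colon-P (scal α s)  bK = ⟶*-scal α (colon-Ξ colon-P s bK)

  colon-⟶a∪β* : ∀ {n} {M M' : Term n} → M ⟶a∪β* M' → ∀ {K} → Base K → colon M K ⟶* colon M' K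
  colon-⟶a∪β* ε                bK = ε
  colon-⟶a∪β* (inl s ◅ M⟶*M') bK = colon-Ξ (λ r _ → colon-A∪L r _) s bK ◅◅ colon-⟶a∪β* M⟶*M' bK
  colon-⟶a∪β* (inr s ◅ M⟶*M') bK = colon-Ξ colon-βn s bK ◅◅ colon-⟶a∪β* M⟶*M' bK

  colon-I-⟶*-Φ : ∀ {n} {V : Term n} (v : Value V) → colon V I ⟶* Φ v
  colon-I-⟶*-Φ 𝟘              = ε
  colon-I-⟶*-Φ (base (var i)) = ε
  colon-I-⟶*-Φ (base (ƛ M))   = βv⇒⟶* (βv (var zero) (ƛ (tr M)))
  colon-I-⟶*-Φ (α · v)        = ⟶*-scal α (colon-I-⟶*-Φ v)
  colon-I-⟶*-Φ (v ⊕ w)        = ⟶*-plus (colon-I-⟶*-Φ v) (colon-I-⟶*-Φ w)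

  tr-I-⟶*-Φ : ∀ {n} (M V : Term n) (v : Value V) → M ⟶a∪β* V → app (tr M) I ⟶* Φ v
  tr-I-⟶*-Φ M V v M⟶*V =
    tr-⟶*-colon M (ƛ _) ◅◅ colon-⟶a∪β* M⟶*V (ƛ _) ◅◅ colon-I-⟶*-Φ v

theorem8 : ∀ {c ℓ} (R : Ring c ℓ) → (∀ {a b} → Ring._≈_ R a b → a ≡ b) →
    let open Lang R in
    (M V : Term 0) (v : Value V) → M ⟶a∪β* V → app (tr M) (ƛ (var zero)) ⟶ℓ∪β* Φ v
theorem8 R _ = CPS.tr-I-⟶*-Φ R
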